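{- Let $G$ be an abelian group (written additively with $\oplus$, identity $\mathcal O$), and let $N$ be an odd positive integer such that there is a group isomorphism $\psi:(\mathbb Z/N\mathbb Z)\times(\mathbb Z/N\mathbb Z)\to G[N]$. For $1\le k\le N^2$ write $k-1 = m+Nn$ with $0\le m,n<N$ and set $R_k=\psi((m,n))$. Let $a,b,c,d,x_1,y_1$ be integers and define, for $1\le k\le N^2$, \[ x_k \equiv x_1 + a(k-1) + b\left\lfloor \tfrac{k-1}{N}\right\rfloor \pmod N,\qquad y_k \equiv y_1 + c(k-1) + d\left\lfloor \tfrac{k-1}{N}\right\rfloor \pmod N. \] If $N$ is relatively prime to $a$ and to $b$, then for every $i\in\mathbb Z/N\mathbb Z$ the sum $\sum_{k:\,x_k=i} R_k$ equals $\mathcal O$. If $N$ is relatively prime to $c$ and to $d$, then for every $j\in\mathbb Z/N\mathbb Z$ the sum $\sum_{k:\,y_k=j} R_k$ equals $\mathcal O$.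
   Context: $G[N]=\{P\in G: [N]P=\mathcal O\}$, where $[N]P$ is $P$ added to itself $N$ times. The sum over $k$ with $x_k=i$ is the sum of the entries in the $i$-th column when $R_k$ is placed in grid position $(x_k,y_k)$; similarly for rows with $y_k=j$. $\lfloor\cdot\rfloor$ is the greatest integer function. -}

module Defs where

open import Level using (_⊔_)
open import Algebra.Bundles using (AbelianGroup)
open import Data.Nat as ℕ using (ℕ; zero; suc; NonZero)
open import Data.Nat.DivMod using (_mod_; _/_)
open import Data.Fin using (Fin; toℕ)
open import Data.Product using (_×_; _,_; ∃)
open import Data.List using (List; foldr; filter; upTo)
open import Data.Integer as ℤ using (ℤ; +_)
open import Data.Integer.DivMod using (_%ℕ_)
open import Relation.Binary.PropositionalEquality using (_≡_)

addMod : (N : ℕ) → .{{_ : NonZero N}} → Fin N → Fin N → Fin N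
addMod N p q = (toℕ p ℕ.+ toℕ q) mod N

addMod² : (N : ℕ) → .{{_ : NonZero N}} → Fin N × Fin N → Fin N × Fin N → Fin N × Fin N
addMod² N (p₁ , p₂) (q₁ , q₂) = addMod N p₁ q₁ , addMod N p₂ q₂

-- The (unique) element R_k = ψ((m,n)) where k-1 = t = m + N n, 0 ≤ m,n < N.
-- For t < N*N, t / N < N, so reducing it mod N does not change it.
decomp : (N : ℕ) → .{{_ : NonZero N}} → ℕ → Fin N × Fin N
decomp N t = t mod N , (t / N) mod N

-- x_k (or y_k) as a residue in {0,…,N-1}, with t = k - 1:
-- (x₁ + a t + b ⌊t/N⌋) mod N
coord : (N : ℕ) → .{{_ : NonZero N}} → (x₁ a b : ℤ) → ℕ → ℕ
coord N x₁ a b t = (x₁ ℤ.+ a ℤ.* (+ t) ℤ.+ b ℤ.* (+ (t / N))) %ℕ N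

module _ {c ℓ} (G : AbelianGroup c ℓ) where
  open AbelianGroup G

  mulℕ : ℕ → Carrier → Carrier
  mulℕ zero P = ε
  mulℕ (suc n) P = P ∙ mulℕ n P

  record IsIsoOntoTorsion (N : ℕ) .{{_ : NonZero N}} (ψ : Fin N × Fin N → Carrier) : Set (c ⊔ ℓ) where
    field
      homomorphism : ∀ p q → ψ (addMod² N p q) ≈ ψ p ∙ ψ q
      injective    : ∀ p q → ψ p ≈ ψ q → p ≡ q
      intoTorsion  : ∀ p → mulℕ N (ψ p) ≈ ε
      ontoTorsion  : ∀ P → mulℕ N P ≈ ε → ∃ λ p → ψ p ≈ P

  sumG : (ℕ → Carrier) → List ℕ → Carrier
  sumG f = foldr (λ t acc → f t ∙ acc) ε

module Submission where

open import Defs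
open import Algebra.Bundles using (AbelianGroup)
open import Data.Nat using (ℕ; NonZero; _*_)
open import Data.Nat.Divisibility using (_∣_)
open import Data.Nat.Coprimality using (Coprime)
open import Data.Nat.Properties using (_≟_)
open import Data.Fin using (Fin; toℕ)
open import Data.Product using (_×_)
open import Data.List using (filter; upTo)
open import Data.Integer using (ℤ; ∣_∣)
open import Relation.Nullary using (¬_)

open import Data.Nat using (zero; suc; _+_; _<_; z<s; s<s; s<s⁻¹; s≤s)
open import Data.Nat.DivMod using (_%_; _/_; _mod_)
import Data.Nat.DivMod as ℕDM
import Data.Nat.Properties as ℕP
import Data.Nat.Divisibility as ℕD
import Data.Nat.Coprimality as ℕC
import Data.Fin as F
import Data.Fin.Properties as FP
open import Data.Product using (∃; _,_)
open import Data.List using (List; []; _∷_; _++_; length; map; applyUpTo)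
open import Data.Nat.ListAction using (sum)
import Data.Nat.ListAction.Properties as ListSum
import Data.List.Properties as LP
open import Data.List.Relation.Unary.All using (All; []; _∷_)
import Data.List.Relation.Unary.All.Properties as AllP
import Data.Integer as ℤ
import Data.Integer.Properties as ℤP
import Data.Integer.Divisibility.Signed as ℤD
import Data.Integer.Coprimality as ℤC
open import Data.Integer.DivMod using (_%ℕ_; _/ℕ_; a≡a%ℕn+[a/ℕn]*n; n%ℕd<d)
open import Data.Integer.Tactic.RingSolver using (solve-∀)
import Data.Nat.Tactic.RingSolver as ℕRing
open import Relation.Nullary using (yes; no)
open import Relation.Unary using (Pred; Decidable)
open import Function.Definitions using (Injective)
open import Data.Empty using (⊥-elim)
open import Relation.Binary.PropositionalEquality

-- Fix a residue r and let S be the list of indices t = k-1 < N² whose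
-- x-coordinate is r.  Write t = nN + m with 0 ≤ m, n < N.  On the n-th block of N
-- consecutive indices the coordinate is (x₁ + b n + a nN) + a m mod N, an injective
-- and hence bijective function of m since a is a unit mod N.  So S meets every block
-- exactly once, and the quotients ⌊t/N⌋ over S are exactly 0, 1, …, N-1.  Therefore
-- Σ⌊t/N⌋ = N(N-1)/2 ≡ 0 (N is odd), and adding up the N congruences
-- x₁ + a t + b⌊t/N⌋ ≡ r yields a·Σt ≡ 0, whence Σt ≡ 0 (mod N).  As ψ is a
-- homomorphism, Σ_{t∈S} ψ(t mod N, ⌊t/N⌋ mod N) = ψ(Σt mod N, Σ⌊t/N⌋ mod N) = ψ(0,0) = O.

applyUpTo-++ : ∀ {a} {A : Set a} (f : ℕ → A) p q →
               applyUpTo f (p + q) ≡ applyUpTo f p ++ applyUpTo (λ x → f (p + x)) q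
applyUpTo-++ f zero    q = refl
applyUpTo-++ f (suc p) q = cong (f 0 ∷_) (applyUpTo-++ (λ x → f (suc x)) p q)

filter-unique-hit : ∀ {a p} {A : Set a} {P : Pred A p} (P? : Decidable P) (f : ℕ → A) n m →
                    m < n → P (f m) → (∀ k → k < n → P (f k) → k ≡ m) →
                    filter P? (applyUpTo f n) ≡ f m ∷ []
filter-unique-hit {P = P} P? f (suc n) zero _ hit only =
  trans (LP.filter-accept P? hit) (cong (f 0 ∷_) (LP.filter-none P? noOtherHit))
  where
    noOtherHit : All (λ x → ¬ P x) (applyUpTo (λ k → f (suc k)) n)
    noOtherHit = AllP.applyUpTo⁺₁ (λ k → f (suc k)) n
                   (λ {k} k<n hitₖ → ℕP.0≢1+n (sym (only (suc k) (s<s k<n) hitₖ)))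
filter-unique-hit P? f (suc n) (suc m) m<n hit only =
  trans (LP.filter-reject P? (λ hit₀ → ℕP.0≢1+n (only 0 z<s hit₀)))
        (filter-unique-hit P? (λ k → f (suc k)) n m (s<s⁻¹ m<n) hit
           (λ k k<n hitₖ → ℕP.suc-injective (only (suc k) (s<s k<n) hitₖ)))

T : ℕ → ℕ
T n = sum (upTo n)

T-suc : ∀ n → T (suc n) ≡ T n + n
T-suc n = begin
  sum (upTo (suc n))      ≡⟨ cong sum (sym (LP.upTo-∷ʳ n)) ⟩
  sum (upTo n ++ n ∷ [])  ≡⟨ ListSum.sum-++ (upTo n) (n ∷ []) ⟩
  T n + (n + 0)           ≡⟨ cong (T n +_) (ℕP.+-identityʳ n) ⟩
  T n + n                 ∎
  where open ≡-Reasoning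

T-double : ∀ n → T n * 2 + n ≡ n * n
T-double zero    = refl
T-double (suc n) = begin
  T (suc n) * 2 + suc n        ≡⟨ cong (λ s → s * 2 + suc n) (T-suc n) ⟩
  (T n + n) * 2 + suc n        ≡⟨ regroup (T n) n ⟩
  (T n * 2 + n) + (n + suc n)  ≡⟨ cong (_+ (n + suc n)) (T-double n) ⟩
  n * n + (n + suc n)          ≡⟨ square-suc n ⟩
  suc n * suc n                ∎
  where
    open ≡-Reasoning
    regroup : ∀ s n → (s + n) * 2 + (1 + n) ≡ (s * 2 + n) + (n + (1 + n))
    regroup = ℕRing.solve-∀
    square-suc : ∀ n → n * n + (n + (1 + n)) ≡ (1 + n) * (1 + n)
    square-suc = ℕRing.solve-∀

odd⇒coprime-2 : ∀ {N} → ¬ (2 ∣ N) → Coprime N 2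
odd⇒coprime-2 odd {zero}              (_ , d∣2) with () ← ℕD.0∣⇒≡0 d∣2
odd⇒coprime-2 odd {suc zero}          _         = refl
odd⇒coprime-2 odd {suc (suc zero)}    (2∣N , _) = ⊥-elim (odd 2∣N)
odd⇒coprime-2 odd {suc (suc (suc _))} (_ , d∣2) with ℕD.∣⇒≤ d∣2
... | s≤s (s≤s ())

odd⇒∣T : ∀ N → ¬ (2 ∣ N) → N ∣ T N
odd⇒∣T N odd = ℕC.coprime-divisor (odd⇒coprime-2 odd) (subst (N ∣_) (ℕP.*-comm (T N) 2) N∣2T)
  where
    N∣2T+N : N ∣ T N * 2 + N
    N∣2T+N = subst (N ∣_) (sym (T-double N)) (ℕD.m∣m*n N)
    N∣2T : N ∣ T N * 2
    N∣2T = ℕD.∣m+n∣m⇒∣n (subst (N ∣_) (ℕP.+-comm (T N * 2) N) N∣2T+N) ℕD.∣-refl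

block-quotient : ∀ {N} .{{_ : NonZero N}} n {m} → m < N → (n * N + m) / N ≡ n
block-quotient {N} n {m} m<N = begin
  (n * N + m) / N    ≡⟨ ℕDM.+-distrib-/-∣ˡ m (ℕD.n∣m*n n) ⟩
  n * N / N + m / N  ≡⟨ cong₂ _+_ (ℕDM.m*n/n≡m n N) (ℕDM.m<n⇒m/n≡0 m<N) ⟩
  n + 0              ≡⟨ ℕP.+-identityʳ n ⟩
  n                  ∎
  where open ≡-Reasoning

infix 4 _≡_[mod_]
_≡_[mod_] : ℤ → ℤ → ℕ → Set
x ≡ y [mod N ] = ℤ.+ N ℤD.∣ x ℤ.- y

module Congruence (N : ℕ) .{{_ : NonZero N}} where

  %ℕ-≡⇒≡[mod] : ∀ x y → x %ℕ N ≡ y %ℕ N → x ≡ y [mod N ]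
  %ℕ-≡⇒≡[mod] x y same = ℤD.divides (qx ℤ.- qy) (begin
    x ℤ.- y                                          ≡⟨ cong₂ ℤ._-_ (a≡a%ℕn+[a/ℕn]*n x N) (a≡a%ℕn+[a/ℕn]*n y N) ⟩
    (ℤ.+ (x %ℕ N) ℤ.+ qx ℤ.* n) ℤ.- (ℤ.+ (y %ℕ N) ℤ.+ qy ℤ.* n)
      ≡⟨ cong (λ s → (ℤ.+ s ℤ.+ qx ℤ.* n) ℤ.- (ℤ.+ (y %ℕ N) ℤ.+ qy ℤ.* n)) same ⟩
    (ℤ.+ (y %ℕ N) ℤ.+ qx ℤ.* n) ℤ.- (ℤ.+ (y %ℕ N) ℤ.+ qy ℤ.* n) ≡⟨ difference (ℤ.+ (y %ℕ N)) qx qy n ⟩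
    (qx ℤ.- qy) ℤ.* n                                ∎)
    where
      open ≡-Reasoning
      n qx qy : ℤ
      n = ℤ.+ N
      qx = x /ℕ N
      qy = y /ℕ N
      difference : ∀ r q q' n → (r ℤ.+ q ℤ.* n) ℤ.- (r ℤ.+ q' ℤ.* n) ≡ (q ℤ.- q') ℤ.* n
      difference = solve-∀

  +-cancelˡ-≡[mod] : ∀ c x y → c ℤ.+ x ≡ c ℤ.+ y [mod N ] → x ≡ y [mod N ]
  +-cancelˡ-≡[mod] c x y = subst (ℤ.+ N ℤD.∣_) (difference c x y)
    where
      difference : ∀ c x y → (c ℤ.+ x) ℤ.- (c ℤ.+ y) ≡ x ℤ.- y
      difference = solve-∀

  *-cancelˡ-≡[mod] : ∀ a x y → Coprime N ∣ a ∣ → a ℤ.* x ≡ a ℤ.* y [mod N ] → x ≡ y [mod N ]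
  *-cancelˡ-≡[mod] a x y cop ax≡ay = ℤD.∣ᵤ⇒∣ (ℤC.coprime-divisor (ℤ.+ N) a (x ℤ.- y) cop
    (ℤD.∣⇒∣ᵤ (subst (ℤ.+ N ℤD.∣_) (factor a x y) ax≡ay)))
    where
      factor : ∀ a x y → a ℤ.* x ℤ.- a ℤ.* y ≡ a ℤ.* (x ℤ.- y)
      factor = solve-∀

  ≡[mod]⇒≡ : ∀ {m m'} → m < N → m' < N → ℤ.+ m ≡ ℤ.+ m' [mod N ] → m ≡ m'
  ≡[mod]⇒≡ {m} {m'} m<N m'<N m≡m' =
    ℤP.+-injective (ℤP.i-j≡0⇒i≡j _ _ (ℤP.∣i∣≡0⇒i≡0 (multiple-below-N (ℤD.∣⇒∣ᵤ m≡m') distance<N)))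
    where
      multiple-below-N : ∀ {d} → N ∣ d → d < N → d ≡ 0
      multiple-below-N {zero}  _   _   = refl
      multiple-below-N {suc d} N∣d d<N = ⊥-elim (ℕD.>⇒∤ d<N N∣d)
      distance<N : ∣ ℤ.+ m ℤ.- ℤ.+ m' ∣ < N
      distance<N = subst (_< N) (sym (cong ∣_∣ (ℤP.m-n≡m⊖n m m')))
                     (ℕP.≤-<-trans (ℤP.∣m⊝n∣≤m⊔n m m') (ℕP.⊔-lub m<N m'<N))

injective⇒surjective : ∀ {n} (f : Fin n → Fin n) → Injective _≡_ _≡_ f → ∀ y → ∃ λ i → f i ≡ y
injective⇒surjective {suc n} f inj y with FP.any? (λ i → f i F.≟ y)
... | yes hit = hit
... | no miss =
  let i , j , i<j , same = FP.pigeonhole (ℕP.n<1+n n) avoiding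
  in ⊥-elim (FP.<⇒≢ i<j (inj (FP.punchOut-injective (missed i) (missed j) same)))
  where
    missed : ∀ i → y ≢ f i
    missed i y≡fi = miss (i , sym y≡fi)
    avoiding : Fin (suc n) → Fin n
    avoiding i = F.punchOut (missed i)

module Line (N : ℕ) .{{_ : NonZero N}} (x₁ a b : ℤ) (a-unit : Coprime N ∣ a ∣)
            (r : ℕ) (r<N : r < N) where
  open Congruence N

  value : ℕ → ℤ
  value t = x₁ ℤ.+ a ℤ.* ℤ.+ t ℤ.+ b ℤ.* ℤ.+ (t / N)

  value-block : ∀ n {m} → m < N → value (n * N + m) ≡ (x₁ ℤ.+ a ℤ.* ℤ.+ (n * N) ℤ.+ b ℤ.* ℤ.+ n) ℤ.+ a ℤ.* ℤ.+ m
  value-block n {m} m<N =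
    trans (cong (λ q → x₁ ℤ.+ a ℤ.* ℤ.+ (n * N + m) ℤ.+ b ℤ.* ℤ.+ q) (block-quotient n m<N))
          (regroup x₁ a (ℤ.+ (n * N)) (ℤ.+ m) (b ℤ.* ℤ.+ n))
    where
      regroup : ∀ x a p m c → x ℤ.+ a ℤ.* (p ℤ.+ m) ℤ.+ c ≡ (x ℤ.+ a ℤ.* p ℤ.+ c) ℤ.+ a ℤ.* m
      regroup = solve-∀

  coord-injective-on-block : ∀ n {m m'} → m < N → m' < N →
                             coord N x₁ a b (n * N + m) ≡ coord N x₁ a b (n * N + m') → m ≡ m'
  coord-injective-on-block n {m} {m'} m<N m'<N same =
    ≡[mod]⇒≡ m<N m'<N (*-cancelˡ-≡[mod] a (ℤ.+ m) (ℤ.+ m') a-unit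
                         (+-cancelˡ-≡[mod] offset (a ℤ.* ℤ.+ m) (a ℤ.* ℤ.+ m') values≡))
    where
      offset : ℤ
      offset = x₁ ℤ.+ a ℤ.* ℤ.+ (n * N) ℤ.+ b ℤ.* ℤ.+ n
      values≡ : offset ℤ.+ a ℤ.* ℤ.+ m ≡ offset ℤ.+ a ℤ.* ℤ.+ m' [mod N ]
      values≡ = subst₂ (λ u v → u ≡ v [mod N ]) (value-block n m<N) (value-block n m'<N)
                       (%ℕ-≡⇒≡[mod] (value (n * N + m)) (value (n * N + m')) same)

  onBlock : ℕ → Fin N → Fin N
  onBlock n i = F.fromℕ< (n%ℕd<d (value (n * N + toℕ i)) N)

  toℕ-onBlock : ∀ n i → toℕ (onBlock n i) ≡ coord N x₁ a b (n * N + toℕ i)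
  toℕ-onBlock n i = FP.toℕ-fromℕ< _

  onBlock-injective : ∀ n → Injective _≡_ _≡_ (onBlock n)
  onBlock-injective n {i} {j} same = FP.toℕ-injective
    (coord-injective-on-block n (FP.toℕ<n i) (FP.toℕ<n j)
      (trans (sym (toℕ-onBlock n i)) (trans (cong toℕ same) (toℕ-onBlock n j))))

  block-hit : ∀ n → ∃ λ m → m < N × coord N x₁ a b (n * N + m) ≡ r
  block-hit n =
    let i , hitᵢ = injective⇒surjective (onBlock n) (onBlock-injective n) (F.fromℕ< r<N)
    in toℕ i , FP.toℕ<n i , trans (sym (toℕ-onBlock n i)) (trans (cong toℕ hitᵢ) (FP.toℕ-fromℕ< r<N))

  onLine? : Decidable (λ t → coord N x₁ a b t ≡ r)
  onLine? t = coord N x₁ a b t ≟ r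

  S : ℕ → List ℕ
  S n = filter onLine? (upTo (n * N))

  block-quotients : ∀ n → map (_/ N) (filter onLine? (applyUpTo (n * N +_) N)) ≡ n ∷ []
  block-quotients n = from-hit (block-hit n)
    where
      from-hit : (∃ λ m → m < N × coord N x₁ a b (n * N + m) ≡ r) →
                 map (_/ N) (filter onLine? (applyUpTo (n * N +_) N)) ≡ n ∷ []
      from-hit (m , m<N , hit) =
        trans (cong (map (_/ N)) (filter-unique-hit onLine? (n * N +_) N m m<N hit unique))
              (cong (_∷ []) (block-quotient n m<N))
        where
          unique : ∀ k → k < N → coord N x₁ a b (n * N + k) ≡ r → k ≡ m
          unique k k<N hitₖ = coord-injective-on-block n k<N m<N (trans hitₖ (sym hit))

  S-quotients : ∀ n → map (_/ N) (S n) ≡ upTo n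
  S-quotients zero    = refl
  S-quotients (suc n) = begin
    map (_/ N) (filter onLine? (upTo (N + n * N)))
      ≡⟨ cong (λ ts → map (_/ N) (filter onLine? ts)) split-off-block ⟩
    map (_/ N) (filter onLine? (earlier ++ block))
      ≡⟨ cong (map (_/ N)) (LP.filter-++ onLine? earlier block) ⟩
    map (_/ N) (S n ++ filter onLine? block)
      ≡⟨ LP.map-++ (_/ N) (S n) (filter onLine? block) ⟩
    map (_/ N) (S n) ++ map (_/ N) (filter onLine? block)
      ≡⟨ cong₂ _++_ (S-quotients n) (block-quotients n) ⟩
    upTo n ++ n ∷ []
      ≡⟨ LP.upTo-∷ʳ n ⟩
    upTo (suc n) ∎
    where
      open ≡-Reasoning
      earlier block : List ℕ
      earlier = upTo (n * N)
      block = applyUpTo (n * N +_) N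
      split-off-block : upTo (N + n * N) ≡ earlier ++ block
      split-off-block = trans (cong upTo (ℕP.+-comm N (n * N))) (applyUpTo-++ (λ t → t) (n * N) N)

  length-S : length (S N) ≡ N
  length-S = trans (sym (LP.length-map (_/ N) (S N))) (trans (cong length (S-quotients N)) (LP.length-upTo N))

  N∣Σquotients : ¬ (2 ∣ N) → N ∣ sum (map (_/ N) (S N))
  N∣Σquotients odd = subst (N ∣_) (sym (cong sum (S-quotients N))) (odd⇒∣T N odd)

  summed-congruence : ∀ L → All (λ t → coord N x₁ a b t ≡ r) L →
    ℤ.+ (length L) ℤ.* (x₁ ℤ.- ℤ.+ r) ℤ.+ a ℤ.* ℤ.+ (sum L) ℤ.+ b ℤ.* ℤ.+ (sum (map (_/ N) L)) ≡ ℤ.+ 0 [mod N ]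
  summed-congruence []      []          = ℤD.divides (ℤ.+ 0) (vanish (x₁ ℤ.- ℤ.+ r) a b (ℤ.+ N))
    where
      vanish : ∀ w a b n → ℤ.+ 0 ℤ.* w ℤ.+ a ℤ.* ℤ.+ 0 ℤ.+ b ℤ.* ℤ.+ 0 ℤ.- ℤ.+ 0 ≡ ℤ.+ 0 ℤ.* n
      vanish = solve-∀
  summed-congruence (t ∷ L) (onLine ∷ L-onLine) =
    subst (ℤ.+ N ℤD.∣_) (sym (split x₁ (ℤ.+ r) (ℤ.+ (length L)) a b (ℤ.+ t) (ℤ.+ (sum L)) (ℤ.+ (t / N)) (ℤ.+ (sum (map (_/ N) L)))))
      (ℤD.∣m∣n⇒∣m+n t≡r (summed-congruence L L-onLine))
    where
      t≡r : value t ≡ ℤ.+ r [mod N ]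
      t≡r = %ℕ-≡⇒≡[mod] (value t) (ℤ.+ r) (trans onLine (sym (ℕDM.m<n⇒m%n≡m r<N)))
      split : ∀ x r l a b t s q s' →
        (ℤ.+ 1 ℤ.+ l) ℤ.* (x ℤ.- r) ℤ.+ a ℤ.* (t ℤ.+ s) ℤ.+ b ℤ.* (q ℤ.+ s') ℤ.- ℤ.+ 0
          ≡ ((x ℤ.+ a ℤ.* t ℤ.+ b ℤ.* q) ℤ.- r) ℤ.+ (l ℤ.* (x ℤ.- r) ℤ.+ a ℤ.* s ℤ.+ b ℤ.* s' ℤ.- ℤ.+ 0)
      split = solve-∀

  -- Since length S = N and N ∣ Σ⌊t/N⌋, the summed congruence leaves N ∣ a·Σt, so N ∣ Σt.
  N∣ΣS : ¬ (2 ∣ N) → N ∣ sum (S N)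
  N∣ΣS odd = ℤC.coprime-divisor (ℤ.+ N) a (ℤ.+ sum (S N)) a-unit (ℤD.∣⇒∣ᵤ N∣a·ΣS)
    where
      w a·ΣS b·Σq : ℤ
      w = x₁ ℤ.- ℤ.+ r
      a·ΣS = a ℤ.* ℤ.+ sum (S N)
      b·Σq = b ℤ.* ℤ.+ sum (map (_/ N) (S N))
      summed : ℤ.+ N ℤ.* w ℤ.+ a·ΣS ℤ.+ b·Σq ≡ ℤ.+ 0 [mod N ]
      summed = subst (λ l → ℤ.+ l ℤ.* w ℤ.+ a·ΣS ℤ.+ b·Σq ≡ ℤ.+ 0 [mod N ]) length-S
                     (summed-congruence (S N) (AllP.all-filter onLine? (upTo (N * N))))
      isolate : ∀ n w A B → ((n ℤ.* w ℤ.+ A ℤ.+ B ℤ.- ℤ.+ 0) ℤ.- n ℤ.* w) ℤ.- B ≡ A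
      isolate = solve-∀
      N∣a·ΣS : ℤ.+ N ℤD.∣ a·ΣS
      N∣a·ΣS = subst (ℤ.+ N ℤD.∣_) (isolate (ℤ.+ N) w a·ΣS b·Σq)
        (ℤD.∣m∣n⇒∣m-n (ℤD.∣m∣n⇒∣m-n summed (ℤD.∣m⇒∣m*n w ℤD.∣-refl))
                      (ℤD.∣n⇒∣m*n b (ℤD.∣ᵤ⇒∣ (N∣Σquotients odd))))

module TorsionSums {c ℓ} (G : AbelianGroup c ℓ) (N : ℕ) .{{_ : NonZero N}}
                   (ψ : Fin N × Fin N → AbelianGroup.Carrier G) (iso : IsIsoOntoTorsion G N ψ) where
  open AbelianGroup G using (Carrier; _≈_; _∙_; ε; ∙-congˡ; group)
    renaming (sym to ≈-sym; trans to ≈-trans)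
  open IsIsoOntoTorsion iso using (homomorphism)
  open import Algebra.Properties.Group group using (identityʳ-unique)

  ψmod : ℕ → ℕ → Carrier
  ψmod u v = ψ (u mod N , v mod N)

  mod-+ : ∀ u u' → addMod N (u mod N) (u' mod N) ≡ (u + u') mod N
  mod-+ u u' = FP.fromℕ<-cong _ _ residues _ _
    where
      residues : (toℕ (u mod N) + toℕ (u' mod N)) % N ≡ (u + u') % N
      residues = trans (cong₂ (λ p q → (p + q) % N) (FP.toℕ-fromℕ< (ℕDM.m%n<n u N))
                                                           (FP.toℕ-fromℕ< (ℕDM.m%n<n u' N)))
                       (sym (ℕDM.%-distribˡ-+ u u' N))

  ψmod-+ : ∀ u v u' v' → ψmod (u + u') (v + v') ≈ ψmod u v ∙ ψmod u' v'
  ψmod-+ u v u' v' = subst (λ p → ψ p ≈ ψmod u v ∙ ψmod u' v') (cong₂ _,_ (mod-+ u u') (mod-+ v v'))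
                           (homomorphism _ _)

  -- The identity of G is ψ(0,0), since ψ(0,0) = ψ(0,0) ∙ ψ(0,0).
  ψmod-zero : ψmod 0 0 ≈ ε
  ψmod-zero = identityʳ-unique (ψmod 0 0) (ψmod 0 0) (≈-sym (ψmod-+ 0 0 0 0))

  multiple-of-N : ∀ x → N ∣ x → x mod N ≡ 0 mod N
  multiple-of-N x N∣x = FP.fromℕ<-cong _ _ (trans (ℕD.n∣m⇒m%n≡0 x N N∣x) (sym (ℕDM.m*n%n≡0 0 N))) _ _

  sumG-ψ : ∀ L → sumG G (λ t → ψ (decomp N t)) L ≈ ψmod (sum L) (sum (map (_/ N) L))
  sumG-ψ []      = ≈-sym ψmod-zero
  sumG-ψ (t ∷ L) = ≈-trans (∙-congˡ (sumG-ψ L)) (≈-sym (ψmod-+ t (t / N) (sum L) (sum (map (_/ N) L))))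

  sumG-vanishes : ∀ L → N ∣ sum L → N ∣ sum (map (_/ N) L) → sumG G (λ t → ψ (decomp N t)) L ≈ ε
  sumG-vanishes L N∣Σt N∣Σq = ≈-trans (sumG-ψ L)
    (subst (λ p → ψ p ≈ ε) (sym (cong₂ _,_ (multiple-of-N _ N∣Σt) (multiple-of-N _ N∣Σq))) ψmod-zero)

mainTheorem3 : ∀ {c ℓ} (G : AbelianGroup c ℓ) (N : ℕ) .{{_ : NonZero N}} → ¬ (2 ∣ N)
    → (ψ : Fin N × Fin N → AbelianGroup.Carrier G) → IsIsoOntoTorsion G N ψ
    → (a b c d x₁ y₁ : ℤ)
    → (Coprime N ∣ a ∣ → Coprime N ∣ b ∣ → ∀ (i : Fin N)
         → AbelianGroup._≈_ G (sumG G (λ t → ψ (decomp N t)) (filter (λ t → coord N x₁ a b t ≟ toℕ i) (upTo (N * N)))) (AbelianGroup.ε G))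
    × (Coprime N ∣ c ∣ → Coprime N ∣ d ∣ → ∀ (j : Fin N)
         → AbelianGroup._≈_ G (sumG G (λ t → ψ (decomp N t)) (filter (λ t → coord N y₁ c d t ≟ toℕ j) (upTo (N * N)))) (AbelianGroup.ε G))
mainTheorem3 G N odd ψ iso a b c d x₁ y₁ = line-sum x₁ a b , line-sum y₁ c d
  where
    -- One family of lines (columns or rows); the second coefficient need not be a unit.
    line-sum : ∀ x₁ a b → Coprime N ∣ a ∣ → Coprime N ∣ b ∣ → ∀ (i : Fin N)
      → AbelianGroup._≈_ G (sumG G (λ t → ψ (decomp N t)) (filter (λ t → coord N x₁ a b t ≟ toℕ i) (upTo (N * N)))) (AbelianGroup.ε G)
    line-sum x₁ a b a-unit _ i = TorsionSums.sumG-vanishes G N ψ iso (S N) (N∣ΣS odd) (N∣Σquotients odd)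
      where open Line N x₁ a b a-unit (toℕ i) (FP.toℕ<n i)
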